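{- Let $\alpha$ be a countable ordinal, $\mathcal F$ an $\alpha$-uniform family on a final segment $S$ of $\mathbb N$, $M$ an infinite subset of $S$, $u$ a finite subset of $\mathbb N$, and $0<\beta<\alpha$. Then $$\big[(\mathcal F\upharpoonright M)_u\oplus\{u\}\big]^{(\beta)}=\big[(\mathcal F\upharpoonright M)_u\big]^{(\beta)}\oplus\{u\},$$ where the left-hand derivative is taken in the subspace $(\mathcal F\upharpoonright M)_u\oplus\{u\}\subseteq\mathcal F$ and the right-hand derivative in the subspace $(\mathcal F\upharpoonright M)_u\subseteq\mathcal F_u$.
   Context: Notation: a final segment is $\{n,n+1,\dots\}$; $\max(\emptyset)=-1$; $A/n=\{m\in A:n<m\}$, $A/u=A/\max(u)$. For finite $s,t$: $s<_{lex}t$ iff $\min(s\triangle t)\in s$. For $\mathcal F\subseteq[\mathbb N]^{<\infty}$ and finite $u$: $\mathcal F_u=\{s: u\cup s\in\mathcal F,\ \max(u)<\min(s)\}$; $\mathcal F\upharpoonright M=\{s\in\mathcal F:s\subseteq M\}$. For families $\mathcal A,\mathcal B$: $\mathcal A\oplus\mathcal B=\{s\cup t: s\in\mathcal B,\ t\in\mathcal A,\ \max(s)<\min(t)\}$. Uniform families on an infinite $M\subseteq\mathbb N$: $\{\emptyset\}$ is the unique $0$-uniform family; $\mathcal F$ is $(\gamma+1)$-uniform on $M$ if $\mathcal F_{\{n\}}$ is $\gamma$-uniform on $M/n$ for all $n\in M$; for limit $\gamma$, $\mathcal F$ is $\gamma$-uniform on $M$ if there is an increasing sequence $(\gamma_k)_{k\in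 M}$ converging to $\gamma$ with $\mathcal F_{\{k\}}$ $\gamma_k$-uniform on $M/k$ for all $k\in M$. If $\mathcal F$ is uniform on $S$, $\mathcal F_u$ is uniform on the final segment $S/u$. Topology: each uniform family on a final segment carries the order topology of $<_{lex}$ (a well-order on it); subsets carry the subspace topology. CB derivatives: $A'$ is the set of points of $A$ that are limit points of $A$; $A^{(0)}=A$, $A^{(\gamma+1)}=(A^{(\gamma)})'$, $A^{(\lambda)}=\bigcap_{\gamma<\lambda}A^{(\gamma)}$ for limit $\lambda$. -}

module Defs where

open import Data.Nat using (ℕ; _<_; _≤_)
open import Data.List using (List; []; _∷_; _++_; [_])
open import Data.List.Membership.Propositional using (_∈_)
open import Data.List.Relation.Unary.All using (All)
open import Data.List.Relation.Unary.Linked using (Linked)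
open import Data.Maybe using (Maybe; nothing; just)
open import Data.Product using (Σ; ∃; _×_; _,_)
open import Data.Unit using (⊤)
open import Relation.Nullary using (¬_)
open import Relation.Binary.PropositionalEquality using (_≡_)

-- Countable ordinals as Brouwer trees, with the standard preorder
-- (Kraus, Nordvall Forsberg, Xu).

data Ord : Set where
  zero : Ord
  suc  : Ord → Ord
  lim  : (ℕ → Ord) → Ord

infix 4 _≤ₒ_ _<ₒ_ _≈ₒ_

data _≤ₒ_ : Ord → Ord → Set where
  ≤-zero     : ∀ {x} → zero ≤ₒ x
  ≤-trans    : ∀ {x y z} → x ≤ₒ y → y ≤ₒ z → x ≤ₒ z
  ≤-suc-mono : ∀ {x y} → x ≤ₒ y → suc x ≤ₒ suc y
  ≤-cocone   : ∀ {x f} k → x ≤ₒ f k → x ≤ₒ lim f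
  ≤-limiting : ∀ {f x} → (∀ k → f k ≤ₒ x) → lim f ≤ₒ x

_<ₒ_ : Ord → Ord → Set
x <ₒ y = suc x ≤ₒ y

_≈ₒ_ : Ord → Ord → Set
x ≈ₒ y = (x ≤ₒ y) × (y ≤ₒ x)

IsLimitOrd : Ord → Set
IsLimitOrd γ = (zero <ₒ γ) × (∀ δ → δ <ₒ γ → suc δ <ₒ γ)

-- Finite subsets of ℕ are represented by strictly increasing lists;
-- subsets of ℕ by predicates; families by predicates on lists.

Fam : Set₁
Fam = List ℕ → Set

Increasing : List ℕ → Set
Increasing = Linked _<_

FinalSeg : ℕ → ℕ → Set
FinalSeg n₀ n = n₀ ≤ n

Infinite : (ℕ → Set) → Set
Infinite M = ∀ n → ∃ λ m → (n < m) × M m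

_/ₛ_ : (ℕ → Set) → ℕ → (ℕ → Set)
(M /ₛ n) m = M m × (n < m)

-- max(s) < min(t)  (with max ∅ = -1; vacuous when t = ∅)
Below : List ℕ → List ℕ → Set
Below s t = ∀ {x y} → x ∈ s → y ∈ t → x < y

FamOn : (ℕ → Set) → Fam → Set
FamOn M F = ∀ s → F s → Increasing s × All M s

section : Fam → List ℕ → Fam
section F u s = F (u ++ s) × Below u s

restrict : Fam → (ℕ → Set) → Fam
restrict F M s = F s × All M s

_⊕_ : Fam → Fam → Fam
(A ⊕ B) r = Σ (List ℕ) λ s → Σ (List ℕ) λ t → B s × A t × Below s t × (r ≡ s ++ t)

single : List ℕ → Fam
single u s = s ≡ u

data Uniform : (ℕ → Set) → Ord → Fam → Set₁ where
  unif-zero : ∀ {M α F} → α ≈ₒ zero → FamOn M F →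
              (∀ s → F s → s ≡ []) → F [] → Uniform M α F
  unif-suc  : ∀ {M α F} (γ : Ord) → α ≈ₒ suc γ → FamOn M F →
              (∀ n → M n → Uniform (M /ₛ n) γ (section F [ n ])) →
              Uniform M α F
  unif-lim  : ∀ {M α F} → IsLimitOrd α → FamOn M F → (g : ℕ → Ord) →
              (∀ k k' → M k → M k' → k < k' → g k <ₒ g k') →
              (∀ k → M k → g k <ₒ α) →
              (∀ δ → δ <ₒ α → ∃ λ k → M k × (δ ≤ₒ g k)) →
              (∀ k → M k → Uniform (M /ₛ k) (g k) (section F [ k ])) →
              Uniform M α F

-- Lexicographic order: s <lex t iff min(s △ t) ∈ s.

_<lex_ : List ℕ → List ℕ → Set
s <lex t = ∃ λ m → m ∈ s × ¬ (m ∈ t) ×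
             (∀ k → k < m → ((k ∈ s → k ∈ t) × (k ∈ t → k ∈ s)))

-- Order topology of the ambient family X (ordered by <lex).
-- Basic neighbourhoods of s: (lo, hi) with lo, hi ∈ X ∪ {±∞}, lo < s < hi.

LowerOK : Fam → Maybe (List ℕ) → List ℕ → Set
LowerOK X nothing  s = ⊤
LowerOK X (just a) s = X a × (a <lex s)

UpperOK : Fam → Maybe (List ℕ) → List ℕ → Set
UpperOK X nothing  s = ⊤
UpperOK X (just b) s = X b × (s <lex b)

AboveLo : Maybe (List ℕ) → List ℕ → Set
AboveLo nothing  t = ⊤
AboveLo (just a) t = a <lex t

BelowHi : Maybe (List ℕ) → List ℕ → Set
BelowHi nothing  t = ⊤
BelowHi (just b) t = t <lex b

IsLimitPoint : Fam → Fam → List ℕ → Set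
IsLimitPoint X A s = ∀ lo hi → LowerOK X lo s → UpperOK X hi s →
  ∃ λ t → A t × ¬ (t ≡ s) × AboveLo lo t × BelowHi hi t

derived : Fam → Fam → Fam
derived X A s = A s × IsLimitPoint X A s

-- A^(β); at a limit tree lim f this is ⋂ₙ A^(f n), which equals
-- ⋂_{γ<sup f} A^(γ) since derivatives decrease.
Deriv : Fam → Fam → Ord → Fam
Deriv X A zero    = A
Deriv X A (suc β) = derived X (Deriv X A β)
Deriv X A (lim f) s = ∀ n → Deriv X A (f n) s

module Submission where

-- Write u ++ t for the set u ∪ t when t lies above u.  The family
-- (F↾M)_u ⊕ {u} is then the image of P = (F↾M)_u ⊆ F_u under t ↦ u ++ t,
-- and the theorem says that this map commutes with Cantor–Bendixson
-- derivatives.  The proof shows that t ↦ u ++ t is a homeomorphism from P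
-- (inside F_u) onto P ⊕ {u} (inside F), at the level of basic
-- neighbourhoods:
--   * prefixing and stripping u preserves the lexicographic order;
--   * a bound l ∈ F of u ++ t either is decided inside u (so it bounds
--     u ++ t' for every t' above u and may be dropped), or l = u ++ a with
--     a ∈ F_u, which is a bound of the same kind for t.
-- Hence limit points correspond, so A' commutes with ⊕ {u}; transfinite
-- induction gives the statement for every β.

open import Defs
open import Data.Nat using (ℕ; _≤_; _<_; _≤?_)
open import Data.Nat.Properties using (≰⇒>; <⇒≤; <-≤-trans; ≤-<-trans; <-cmp; <-asym; <-irrefl; <-trans)
open import Data.List using (List; []; _∷_; _++_)
open import Data.List.Properties using (++-cancelˡ)
open import Data.List.Membership.Propositional using (_∈_; find; lose)
open import Data.List.Membership.Propositional.Properties using (∈-++⁻; ∈-++⁺ˡ; ∈-++⁺ʳ)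
open import Data.List.Relation.Unary.Any using (here; there; any?)
open import Data.List.Relation.Unary.Linked using (_∷_; tail)
open import Data.Maybe using (Maybe; nothing; just)
open import Data.Product using (Σ; ∃; _×_; _,_; proj₁; proj₂; swap)
open import Data.Sum using (_⊎_; inj₁; inj₂)
open import Data.Unit using (tt)
open import Data.Empty using (⊥-elim)
open import Relation.Nullary using (¬_; yes; no)
open import Relation.Binary using (tri<; tri≈; tri>)
open import Relation.Binary.PropositionalEquality using (_≡_; refl; cong; sym; subst)

_↔_ : Set → Set → Set
A ↔ B = (A → B) × (B → A)

↔-trans : ∀ {A B C : Set} → A ↔ B → B ↔ C → A ↔ C
↔-trans (f , g) (h , k) = (λ a → h (f a)) , (λ c → g (k c))

head<tail : ∀ {x xs y} → Increasing (x ∷ xs) → y ∈ xs → x < y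
head<tail (x<z ∷ _)   (here refl) = x<z
head<tail (x<z ∷ inc) (there y∈)  = <-trans x<z (head<tail inc y∈)

below-head-∉ : ∀ {x y r} → Increasing (y ∷ r) → x < y → ¬ x ∈ y ∷ r
below-head-∉ inc x<y (here refl) = <-irrefl refl x<y
below-head-∉ inc x<y (there x∈r) = <-asym x<y (head<tail inc x∈r)

prefix-below : ∀ u a → Increasing (u ++ a) → Below u a
prefix-below (x ∷ u) a inc (here refl) y∈a = head<tail inc (∈-++⁺ʳ u y∈a)
prefix-below (x ∷ u) a inc (there x∈u) y∈a = prefix-below u a (tail inc) x∈u y∈a

above-∉ : ∀ {u t k} → Below u t → k ∈ t → ¬ k ∈ u
above-∉ bt k∈t k∈u = <-irrefl refl (bt k∈u k∈t)

small-in-prefix : ∀ {u t k y} → Below u t → y ∈ u → k ≤ y → k ∈ u ++ t → k ∈ u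
small-in-prefix {u} bt y∈u k≤y k∈ with ∈-++⁻ u k∈
... | inj₁ k∈u = k∈u
... | inj₂ k∈t = ⊥-elim (<-irrefl refl (≤-<-trans k≤y (bt y∈u k∈t)))

reaches : ∀ m u → (∃ λ y → y ∈ u × m ≤ y) ⊎ (∀ {y} → y ∈ u → y < m)
reaches m u with any? (m ≤?_) u
... | yes some = inj₁ (find some)
... | no none  = inj₂ λ y∈u → ≰⇒> λ m≤y → none (lose y∈u m≤y)

Agree : ℕ → List ℕ → List ℕ → Set
Agree m s t = ∀ k → k < m → (k ∈ s → k ∈ t) × (k ∈ t → k ∈ s)

LexAt : ℕ → List ℕ → List ℕ → Set
LexAt m s t = m ∈ s × ¬ m ∈ t × Agree m s t

agree-sym : ∀ {m s t} → Agree m s t → Agree m t s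
agree-sym ag k k<m = swap (ag k k<m)

extend-⊆ : ∀ (u : List ℕ) {a t k} → (k ∈ a → k ∈ t) → k ∈ u ++ a → k ∈ u ++ t
extend-⊆ u a⊆t k∈ with ∈-++⁻ u k∈
... | inj₁ k∈u = ∈-++⁺ˡ k∈u
... | inj₂ k∈a = ∈-++⁺ʳ u (a⊆t k∈a)

strip-⊆ : ∀ (u : List ℕ) {a t k} → Below u a → (k ∈ u ++ a → k ∈ u ++ t) → k ∈ a → k ∈ t
strip-⊆ u ba ua⊆ut k∈a with ∈-++⁻ u (ua⊆ut (∈-++⁺ʳ u k∈a))
... | inj₁ k∈u = ⊥-elim (above-∉ ba k∈a k∈u)
... | inj₂ k∈t = k∈t

lexAt-prefix : ∀ u {a t m} → Below u a → LexAt m a t → LexAt m (u ++ a) (u ++ t)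
lexAt-prefix u {a} {t} {m} ba (m∈a , m∉t , ag) =
  ∈-++⁺ʳ u m∈a , m∉ut , λ k k<m → extend-⊆ u (proj₁ (ag k k<m)) , extend-⊆ u (proj₂ (ag k k<m))
  where
  m∉ut : ¬ m ∈ u ++ t
  m∉ut m∈ with ∈-++⁻ u m∈
  ... | inj₁ m∈u = above-∉ ba m∈a m∈u
  ... | inj₂ m∈t = m∉t m∈t

lexAt-strip : ∀ {u a t m} → Below u a → Below u t → LexAt m (u ++ a) (u ++ t) → LexAt m a t
lexAt-strip {u} {a} {t} {m} ba bt (m∈ua , m∉ut , ag) =
  m∈a , (λ m∈t → m∉ut (∈-++⁺ʳ u m∈t)) ,
  λ k k<m → strip-⊆ u ba (proj₁ (ag k k<m)) , strip-⊆ u bt (proj₂ (ag k k<m))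
  where
  m∈a : m ∈ a
  m∈a with ∈-++⁻ u m∈ua
  ... | inj₁ m∈u = ⊥-elim (m∉ut (∈-++⁺ˡ m∈u))
  ... | inj₂ m∈a = m∈a

agree-change-tail : ∀ {u t t' l m y} → Below u t → Below u t' → y ∈ u → m ≤ y →
  Agree m l (u ++ t) → Agree m l (u ++ t')
agree-change-tail bt bt' y∈u m≤y ag k k<m =
  (λ k∈l → ∈-++⁺ˡ (small-in-prefix bt y∈u k≤y (proj₁ (ag k k<m) k∈l))) ,
  (λ k∈ut' → proj₂ (ag k k<m) (∈-++⁺ˡ (small-in-prefix bt' y∈u k≤y k∈ut')))
  where
  k≤y = <⇒≤ (<-≤-trans k<m m≤y)

-- A comparison with u ++ t decided at m ≤ y ∈ u is decided inside u, so it
-- holds for u ++ t' as well, for every t' above u.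
cut-left : ∀ {u t t' l m y} → Below u t → Below u t' → y ∈ u → m ≤ y →
  LexAt m l (u ++ t) → LexAt m l (u ++ t')
cut-left bt bt' y∈u m≤y (m∈l , m∉ut , ag) =
  m∈l , (λ m∈ut' → m∉ut (∈-++⁺ˡ (small-in-prefix bt' y∈u m≤y m∈ut'))) ,
  agree-change-tail bt bt' y∈u m≤y ag

cut-right : ∀ {u t t' h m y} → Below u t → Below u t' → y ∈ u → m ≤ y →
  LexAt m (u ++ t) h → LexAt m (u ++ t') h
cut-right bt bt' y∈u m≤y (m∈ut , m∉h , ag) =
  ∈-++⁺ˡ (small-in-prefix bt y∈u m≤y m∈ut) , m∉h ,
  agree-sym (agree-change-tail bt bt' y∈u m≤y (agree-sym ag))

same-head : ∀ {x y s r m} → Increasing (x ∷ s) → Increasing (y ∷ r) → y < m →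
  Agree m (x ∷ s) (y ∷ r) → x ≡ y
same-head {x} {y} incS incR y<m ag with <-cmp x y
... | tri≈ _ x≡y _ = x≡y
... | tri< x<y _ _ = ⊥-elim (below-head-∉ incR x<y (proj₁ (ag x (<-trans x<y y<m)) (here refl)))
... | tri> _ _ y<x = ⊥-elim (below-head-∉ incS y<x (proj₂ (ag y y<m) (here refl)))

agree-tail : ∀ {x s r m} → Increasing (x ∷ s) → Increasing (x ∷ r) →
  Agree m (x ∷ s) (x ∷ r) → Agree m s r
agree-tail incS incR ag k k<m =
  (λ k∈s → drop-head incS k∈s (proj₁ (ag k k<m) (there k∈s))) ,
  (λ k∈r → drop-head incR k∈r (proj₂ (ag k k<m) (there k∈r)))
  where
  drop-head : ∀ {x s r k} → Increasing (x ∷ s) → k ∈ s → k ∈ x ∷ r → k ∈ r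
  drop-head inc k∈s (here refl) = ⊥-elim (<-irrefl refl (head<tail inc k∈s))
  drop-head inc k∈s (there k∈r) = k∈r

prefix-of : ∀ u {s t m} → (∀ {y} → y ∈ u → y < m) → Increasing s → Increasing (u ++ t) →
  Agree m s (u ++ t) → ∃ λ a → s ≡ u ++ a
prefix-of [] _ _ _ _ = _ , refl
prefix-of (y ∷ u) {[]} u<m _ _ ag with proj₂ (ag y (u<m (here refl))) (here refl)
... | ()
prefix-of (y ∷ u) {x ∷ s} u<m incS incU ag with same-head incS incU (u<m (here refl)) ag
... | refl with prefix-of u (λ y∈u → u<m (there y∈u)) (tail incS) (tail incU) (agree-tail incS incU ag)
...   | a , refl = a , refl

Deriv-⊆ : ∀ X A γ {t} → Deriv X A γ t → A t
Deriv-⊆ X A zero    d = d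
Deriv-⊆ X A (suc γ) d = Deriv-⊆ X A γ (proj₁ d)
Deriv-⊆ X A (lim f) d = Deriv-⊆ X A (f 0) (d 0)

derived-resp : ∀ X {A B : Fam} → (∀ s → A s ↔ B s) → ∀ s → derived X A s ↔ derived X B s
derived-resp X {A} {B} A↔B s = transport A↔B , transport (λ s → swap (A↔B s))
  where
  transport : ∀ {A B : Fam} → (∀ s → A s ↔ B s) → derived X A s → derived X B s
  transport e (as , lp) = proj₁ (e s) as , λ lo hi lok hok → witness e (lp lo hi lok hok)
    where
    witness : ∀ {A B : Fam} {Q : List ℕ → Set} → (∀ s → A s ↔ B s) →
      (∃ λ t → A t × Q t) → ∃ λ t → B t × Q t
    witness e (t , at , qt) = t , proj₁ (e t) at , qt

⊕single-inv : ∀ {A u t} → (A ⊕ single u) (u ++ t) → A t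
⊕single-inv {A} {u} {t} (_ , t' , refl , at' , _ , e) = subst A (sym (++-cancelˡ u t t' e)) at'

module Prefixing (F : Fam) (incF : ∀ s → F s → Increasing s) (u : List ℕ) where

  prefixBound : Maybe (List ℕ) → Maybe (List ℕ)
  prefixBound nothing  = nothing
  prefixBound (just a) = just (u ++ a)

  lift-lower : ∀ {t} → Below u t → ∀ lo → LowerOK (section F u) lo t → LowerOK F (prefixBound lo) (u ++ t)
  lift-lower bt nothing  _ = tt
  lift-lower bt (just a) ((fa , ba) , m , a<t) = fa , m , lexAt-prefix u ba a<t

  lift-upper : ∀ {t} → Below u t → ∀ hi → UpperOK (section F u) hi t → UpperOK F (prefixBound hi) (u ++ t)
  lift-upper bt nothing  _ = tt
  lift-upper bt (just b) ((fb , bb) , m , t<b) = fb , m , lexAt-prefix u bt t<b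

  drop-above : ∀ {t t'} → Below u t' → ∀ lo → LowerOK (section F u) lo t →
    AboveLo (prefixBound lo) (u ++ t') → AboveLo lo t'
  drop-above bt' nothing  _ _ = tt
  drop-above bt' (just a) ((_ , ba) , _) (m , a<t') = m , lexAt-strip ba bt' a<t'

  drop-below : ∀ {t t'} → Below u t' → ∀ hi → UpperOK (section F u) hi t →
    BelowHi (prefixBound hi) (u ++ t') → BelowHi hi t'
  drop-below bt' nothing  _ _ = tt
  drop-below bt' (just b) ((_ , bb) , _) (m , t'<b) = m , lexAt-strip bt' bb t'<b

  -- Conversely every lower bound of u ++ t in F is either irrelevant for
  -- lists u ++ t' (t' above u), or of the form u ++ a with a ∈ F_u.
  lower-transfer : ∀ {t} → F (u ++ t) → Below u t → ∀ lo → LowerOK F lo (u ++ t) →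
    Σ (Maybe (List ℕ)) λ lo' → LowerOK (section F u) lo' t ×
      (∀ {t'} → Below u t' → AboveLo lo' t' → AboveLo lo (u ++ t'))
  lower-transfer fut bt nothing _ = nothing , tt , λ _ _ → tt
  lower-transfer fut bt (just l) (fl , m , l<ut) with reaches m u
  ... | inj₁ (y , y∈u , m≤y) = nothing , tt , λ bt' _ → m , cut-left bt bt' y∈u m≤y l<ut
  ... | inj₂ u<m with prefix-of u u<m (incF l fl) (incF _ fut) (proj₂ (proj₂ l<ut))
  ...   | a , refl = just a , ((fl , ba) , m , lexAt-strip ba bt l<ut) ,
                     λ { bt' (m' , a<t') → m' , lexAt-prefix u ba a<t' }
    where
    ba = prefix-below u a (incF _ fl)

  upper-transfer : ∀ {t} → F (u ++ t) → Below u t → ∀ hi → UpperOK F hi (u ++ t) →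
    Σ (Maybe (List ℕ)) λ hi' → UpperOK (section F u) hi' t ×
      (∀ {t'} → Below u t' → BelowHi hi' t' → BelowHi hi (u ++ t'))
  upper-transfer fut bt nothing _ = nothing , tt , λ _ _ → tt
  upper-transfer fut bt (just h) (fh , m , ut<h) with reaches m u
  ... | inj₁ (y , y∈u , m≤y) = nothing , tt , λ bt' _ → m , cut-right bt bt' y∈u m≤y ut<h
  ... | inj₂ u<m with prefix-of u u<m (incF h fh) (incF _ fut) (agree-sym (proj₂ (proj₂ ut<h)))
  ...   | b , refl = just b , ((fh , bb) , m , lexAt-strip bt bb ut<h) ,
                     λ { bt' (m' , t'<b) → m' , lexAt-prefix u bt' t'<b }
    where
    bb = prefix-below u b (incF _ fh)

  module _ (P : Fam) (P⊆Fu : ∀ t → P t → section F u t) where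

    limit-strip : ∀ {t} → Below u t → IsLimitPoint F (P ⊕ single u) (u ++ t) →
      IsLimitPoint (section F u) P t
    limit-strip bt lp lo hi lok hok
      with lp (prefixBound lo) (prefixBound hi) (lift-lower bt lo lok) (lift-upper bt hi hok)
    ... | _ , (_ , t' , refl , pt' , bt' , refl) , ut'≢ut , above , below =
      t' , pt' , (λ t'≡t → ut'≢ut (cong (u ++_) t'≡t)) ,
      drop-above bt' lo lok above , drop-below bt' hi hok below

    limit-prefix : ∀ {t} → P t → IsLimitPoint (section F u) P t →
      IsLimitPoint F (P ⊕ single u) (u ++ t)
    limit-prefix {t} pt lp lo hi lok hok with P⊆Fu t pt
    ... | fut , bt with lower-transfer fut bt lo lok | upper-transfer fut bt hi hok
    ...   | lo' , lok' , raise-lo | hi' , hok' , raise-hi with lp lo' hi' lok' hok'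
    ...     | t' , pt' , t'≢t , above , below =
      u ++ t' , (u , t' , refl , pt' , bt' , refl) , (λ e → t'≢t (++-cancelˡ u t' t e)) ,
      raise-lo bt' above , raise-hi bt' below
      where
      bt' = proj₂ (P⊆Fu t' pt')

    derived-prefix : ∀ r → derived F (P ⊕ single u) r ↔ (derived (section F u) P ⊕ single u) r
    derived-prefix r = to , from
      where
      to : derived F (P ⊕ single u) r → (derived (section F u) P ⊕ single u) r
      to ((_ , t , refl , pt , bt , refl) , lp) = u , t , refl , (pt , limit-strip bt lp) , bt , refl
      from : (derived (section F u) P ⊕ single u) r → derived F (P ⊕ single u) r
      from (_ , t , refl , (pt , lp) , bt , refl) = (u , t , refl , pt , bt , refl) , limit-prefix pt lp

  deriv-prefix : ∀ (P : Fam) → (∀ t → P t → section F u t) → ∀ γ r →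
    Deriv F (P ⊕ single u) γ r ↔ (Deriv (section F u) P γ ⊕ single u) r
  deriv-prefix P P⊆Fu zero r = (λ x → x) , (λ x → x)
  deriv-prefix P P⊆Fu (suc γ) r =
    ↔-trans (derived-resp F (deriv-prefix P P⊆Fu γ) r) (derived-prefix Pγ Pγ⊆Fu r)
    where
    Pγ = Deriv (section F u) P γ
    Pγ⊆Fu : ∀ t → Pγ t → section F u t
    Pγ⊆Fu t d = P⊆Fu t (Deriv-⊆ (section F u) P γ d)
  deriv-prefix P P⊆Fu (lim f) r = to , from
    where
    to : Deriv F (P ⊕ single u) (lim f) r → (Deriv (section F u) P (lim f) ⊕ single u) r
    to d with proj₁ (deriv-prefix P P⊆Fu (f 0) r) (d 0)
    ... | _ , t , refl , _ , bt , refl =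
      u , t , refl , (λ n → ⊕single-inv (proj₁ (deriv-prefix P P⊆Fu (f n) (u ++ t)) (d n))) , bt , refl
    from : (Deriv (section F u) P (lim f) ⊕ single u) r → Deriv F (P ⊕ single u) (lim f) r
    from (_ , t , refl , d , bt , refl) n =
      proj₂ (deriv-prefix P P⊆Fu (f n) (u ++ t)) (u , t , refl , d n , bt , refl)

uniform-increasing : ∀ {M α F} → Uniform M α F → ∀ s → F s → Increasing s
uniform-increasing (unif-zero _ on _ _)       s fs = proj₁ (on s fs)
uniform-increasing (unif-suc _ _ on _)        s fs = proj₁ (on s fs)
uniform-increasing (unif-lim _ on _ _ _ _ _) s fs = proj₁ (on s fs)

restricted-section-⊆ : ∀ F M u t → section (restrict F M) u t → section F u t
restricted-section-⊆ F M u t ((fut , _) , bt) = fut , bt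

-- Uniformity is used only to know that F consists of increasing lists; the
-- identity in fact holds for every ordinal β.
mainTheorem13 : (α : Ord) (F : Fam) (n₀ : ℕ) → Uniform (FinalSeg n₀) α F →
    (M : ℕ → Set) → (∀ n → M n → n₀ ≤ n) → Infinite M →
    (u : List ℕ) → Increasing u →
    (β : Ord) → zero <ₒ β → β <ₒ α →
    ∀ s →
      (Deriv F (section (restrict F M) u ⊕ single u) β s →
        (Deriv (section F u) (section (restrict F M) u) β ⊕ single u) s)
      × ((Deriv (section F u) (section (restrict F M) u) β ⊕ single u) s →
        Deriv F (section (restrict F M) u ⊕ single u) β s)
mainTheorem13 α F n₀ U M _ _ u _ β _ _ =
  Prefixing.deriv-prefix F (uniform-increasing U) u
    (section (restrict F M) u) (restricted-section-⊆ F M u) β
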